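{- Let $\vec S$ be a universe of set separations of a set $V$ with the order function $|X,Y|_r=r(X)+r(Y)-r(V)$ for some non-decreasing submodular function $r:2^V\to\mathbb N$, and let $p\in\mathbb N$. Then $\mathcal F_p=\{\sigma:\sigma$ a star of elements of $\vec S$ with $\langle\sigma\rangle_r<p\}$ is $S$-stable: whenever $\sigma\in\mathcal F_p$ and $(A,B)\in\vec S$ are such that $\sigma\cup\{(A,B)\}$ is a star, then $\sigma\cup\{(A,B)\}\in\mathcal F_p$.
   Context: $\mathrm{sep}(V)=\{(A,B):A\cup B=V\}$ is ordered by $(A,B)\le(C,D)$ iff $A\subseteq C$ and $B\supseteq D$. A universe of set separations is a subset $\vec S\subseteq\mathrm{sep}(V)$ closed under $(A,B)\mapsto(B,A)$ and under $(A,B)\wedge(C,D)=(A\cap C,B\cup D)$ and $(A,B)\vee(C,D)=(A\cup C,B\cap D)$. A star is a finite multiset $\sigma$ of separations such that any two of its members (distinct as members of the multiset) $(A,B),(C,D)$ satisfy $(A,B)\le(D,C)$; $\sigma\cup\{(A,B)\}$ denotes the multiset obtained by adding one copy of $(A,B)$. For a star $\sigma=\{(A_0,B_0),\dots,(A_n,B_n)\}$, $\langle\sigma\rangle_r=\sum_{i=0}^n r(B_i)-n\,r(V)$. -}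

module Defs where

open import Data.Bool using (Bool; true; false; _∧_; _∨_)
open import Data.Nat using (ℕ; _≤_) renaming (_+_ to _+ℕ_)
open import Data.Integer as ℤ using (ℤ; +_; _-_; _*_; _<_)
open import Data.List using (List; []; _∷_; length; map; lookup)
open import Data.Nat.ListAction using (sum)
open import Data.List.Relation.Unary.All using (All)
open import Data.Fin using (Fin)
open import Data.Product using (_×_; _,_; proj₁; proj₂)
open import Relation.Binary.PropositionalEquality using (_≡_; _≢_)

Sub : Set → Set
Sub V = V → Bool

module _ {V : Set} where

  full : Sub V
  full _ = true

  _∪ˢ_ _∩ˢ_ : Sub V → Sub V → Sub V
  (A ∪ˢ B) v = A v ∨ B v
  (A ∩ˢ B) v = A v ∧ B v

  _⊆ˢ_ : Sub V → Sub V → Set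
  A ⊆ˢ B = ∀ v → A v ≡ true → B v ≡ true

  _≐_ : Sub V → Sub V → Set
  A ≐ B = ∀ v → A v ≡ B v

  Pair : Set
  Pair = Sub V × Sub V

  IsSep : Pair → Set
  IsSep (A , B) = ∀ v → (A ∪ˢ B) v ≡ true

  _≤ˢ_ : Pair → Pair → Set
  (A , B) ≤ˢ (C , D) = (A ⊆ˢ C) × (D ⊆ˢ B)

  inv : Pair → Pair
  inv (A , B) = (B , A)

  _⊓_ _⊔_ : Pair → Pair → Pair
  (A , B) ⊓ (C , D) = (A ∩ˢ C , B ∪ˢ D)
  (A , B) ⊔ (C , D) = (A ∪ˢ C , B ∩ˢ D)

  record IsUniverse (S : Pair → Set) : Set where
    field
      sep  : ∀ s → S s → IsSep s
      inv-closed  : ∀ s → S s → S (inv s)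
      meet-closed : ∀ s t → S s → S t → S (s ⊓ t)
      join-closed : ∀ s t → S s → S t → S (s ⊔ t)

  -- r is a function on 2^V: it respects extensional equality of subsets
  RespectsExt : (Sub V → ℕ) → Set
  RespectsExt r = ∀ A B → A ≐ B → r A ≡ r B

  NonDecreasing : (Sub V → ℕ) → Set
  NonDecreasing r = ∀ A B → A ⊆ˢ B → r A ≤ r B

  Submodular : (Sub V → ℕ) → Set
  Submodular r = ∀ A B → r (A ∪ˢ B) +ℕ r (A ∩ˢ B) ≤ r A +ℕ r B

  ord : (Sub V → ℕ) → Pair → ℤ
  ord r (X , Y) = + (r X +ℕ r Y) - + r full

  -- a star: finite multiset (list) such that any two members at distinct
  -- positions (A,B), (C,D) satisfy (A,B) ≤ (D,C)
  IsStar : List Pair → Set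
  IsStar σ = ∀ (i j : Fin (length σ)) → i ≢ j → lookup σ i ≤ˢ inv (lookup σ j)

  -- ⟨σ⟩_r = Σ_{i=0}^{n} r(B_i) - n r(V), where |σ| = n + 1
  starOrd : (Sub V → ℕ) → List Pair → ℤ
  starOrd r σ = + sum (map (λ s → r (proj₂ s)) σ) - ((+ length σ - + 1) * + r full)

  InF : (S : Pair → Set) → (Sub V → ℕ) → ℕ → List Pair → Set
  InF S r p σ = All S σ × IsStar σ × (starOrd r σ < + p)

-- Adding (A , B) to a star raises the sum of the r(Bᵢ) by r(B) and the
-- subtracted multiple of r(V) by r(V), so ⟨σ⟩ drops by r(V) - r(B) ≥ 0,
-- using only that r is non-decreasing.
module Submission where

open import Defs
open import Data.Nat using (ℕ)
import Data.Nat as ℕ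
open import Data.List using (List; _∷_; length; map)
open import Data.Nat.ListAction using (sum)
open import Data.Product using (_,_; proj₂)
open import Data.List.Relation.Unary.All using (_∷_)
open import Data.Integer using (+_; _-_; _*_; _+_; _≤_; +≤+)
open import Data.Integer.Properties using (pos-+; ≤-<-trans; +-monoʳ-≤; i≤j⇒i-j≤0; +-identityʳ)
open import Data.Integer.Solver using (module +-*-Solver)
open import Relation.Binary.PropositionalEquality using (_≡_; refl)

module _ {V : Set} (r : Sub V → ℕ) where

  starOrd-∷ : (s : Pair {V}) (σ : List (Pair {V})) →
    starOrd r (s ∷ σ) ≡ starOrd r σ + (+ r (proj₂ s) - + r full)
  starOrd-∷ (_ , B) σ
    rewrite pos-+ (r B) (sum (map (λ s → r (proj₂ s)) σ)) | pos-+ 1 (length σ) =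
    solve 4 (λ b t n R → (b :+ t) :- ((con (+ 1) :+ n :- con (+ 1)) :* R)
                        := (t :- ((n :- con (+ 1)) :* R)) :+ (b :- R))
          refl (+ r B) (+ sum (map (λ s → r (proj₂ s)) σ)) (+ length σ) (+ r full)
    where open +-*-Solver

  ≤-full : NonDecreasing r → (A : Sub V) → r A ℕ.≤ r full
  ≤-full mono A = mono A full (λ _ _ → refl)

  starOrd-∷-≤ : NonDecreasing r → (s : Pair {V}) (σ : List (Pair {V})) →
    starOrd r (s ∷ σ) ≤ starOrd r σ
  starOrd-∷-≤ mono s σ = begin
    starOrd r (s ∷ σ)                            ≡⟨ starOrd-∷ s σ ⟩
    starOrd r σ + (+ r (proj₂ s) - + r full)     ≤⟨ +-monoʳ-≤ (starOrd r σ) drop≤0 ⟩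
    starOrd r σ + + 0                            ≡⟨ +-identityʳ (starOrd r σ) ⟩
    starOrd r σ                                  ∎
    where
    open Data.Integer.Properties.≤-Reasoning
    drop≤0 : + r (proj₂ s) - + r full ≤ + 0
    drop≤0 = i≤j⇒i-j≤0 (+≤+ (≤-full mono (proj₂ s)))

lemma5p5 : (V : Set) (S : Pair {V} → Set) → IsUniverse S →
    (r : Sub V → ℕ) → RespectsExt r → NonDecreasing r → Submodular r →
    (p : ℕ) → (σ : List (Pair {V})) → InF S r p σ →
    (s : Pair {V}) → S s → IsStar (s ∷ σ) → InF S r p (s ∷ σ)
lemma5p5 V S _ r _ mono _ p σ (Sσ , _ , σ<p) s Ss star =
  (Ss ∷ Sσ) , star , ≤-<-trans (starOrd-∷-≤ r mono s σ) σ<p
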